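{- Let $A$ be a finite totally ordered alphabet, $m\colon A\to\mathbb{Z}^{+}$, and $\mathcal{S}_{(A,m)}$ the set of words in which each $a\in A$ occurs exactly $m(a)$ times. Define $\delta(w)=\{(w_i,\mathtt{d}(w_i),\mathtt{p}(w_i),\mathtt{r}(w_i)) : 1\le i\le n\}$ for $w=w_1\cdots w_n\in\mathcal{S}_{(A,m)}$, and let $L_{\mathcal{S}_{(A,m)}}=\{\delta(w): w\in\mathcal{S}_{(A,m)}\}$. Then $\delta\colon\mathcal{S}_{(A,m)}\to L_{\mathcal{S}_{(A,m)}}$ is a bijection.
   Context: For $w=w_1\cdots w_n$: the duplicate index $\mathtt{d}(w_i)=|\{j\le i: w_j=w_i\}|$ (equal letters are numbered $1,2,\dots$ from left to right). Descent blocks: cut $w$ between $w_i$ and $w_{i+1}$ whenever $w_i\le w_{i+1}$; the maximal pieces are the descent blocks. A block with one letter is an outsider block; for a block $B$ with at least two letters, its leftmost letter is its closer $C(B)$, its rightmost letter its opener $O(B)$, and letters strictly inside are insiders. The position $\mathtt{p}(w_i)\in\{\text{opener},\text{closer},\text{insider},\text{outsider}\}$ records which of these roles $w_i$ has (outsider if its block has one letter). A letter $a$ is embraced by a block $B$ with at least two letters if $O(B)<a<C(B)$; the right embracing number $\mathtt{r}(w_i)$ is the number of descent blocks lying strictly to the right of $w_i$ that embrace $w_i$. -}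

module Defs where

open import Data.Nat using (ℕ; zero; suc; _+_; _≤_; _<ᵇ_; _≡ᵇ_)
open import Data.Bool using (Bool; true; false; if_then_else_; _∧_)
open import Data.Fin using (Fin; toℕ)
open import Data.List using (List; []; _∷_; _++_; length)
open import Data.List.Membership.Propositional using (_∈_)
open import Data.Product using (_×_; _,_; ∃)
open import Function.Bundles using (_⇔_)
open import Relation.Binary.PropositionalEquality using (_≡_)

-- The alphabet A is modelled as Fin k with its natural total order.
Letter : ℕ → Set
Letter k = Fin k

module _ {k : ℕ} where

  _<L_ : Letter k → Letter k → Bool
  a <L b = toℕ a <ᵇ toℕ b

  _=L_ : Letter k → Letter k → Bool
  a =L b = toℕ a ≡ᵇ toℕ b

  countB : {X : Set} → (X → Bool) → List X → ℕ
  countB p [] = 0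
  countB p (x ∷ xs) = if p x then suc (countB p xs) else countB p xs

  occ : Letter k → List (Letter k) → ℕ
  occ a w = countB (λ x → x =L a) w

  InS : (Letter k → ℕ) → List (Letter k) → Set
  InS m w = ∀ a → occ a w ≡ m a

  -- Descent blocks: cut between w_i and w_{i+1} whenever w_i ≤ w_{i+1};
  -- so a block is a maximal strictly decreasing factor.
  addToFirst : Letter k → List (List (Letter k)) → List (List (Letter k))
  addToFirst x [] = (x ∷ []) ∷ []
  addToFirst x (b ∷ bs) = (x ∷ b) ∷ bs

  blocksFrom : Letter k → List (Letter k) → List (List (Letter k))
  blocksFrom x [] = (x ∷ []) ∷ []
  blocksFrom x (y ∷ ys) =
    if y <L x then addToFirst x (blocksFrom y ys)
              else (x ∷ []) ∷ blocksFrom y ys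

  descentBlocks : List (Letter k) → List (List (Letter k))
  descentBlocks [] = []
  descentBlocks (x ∷ xs) = blocksFrom x xs

  data Position : Set where
    opener closer insider outsider : Position

  lastOf : Letter k → List (Letter k) → Letter k
  lastOf x [] = x
  lastOf x (y ∷ ys) = lastOf y ys

  -- block b (with ≥ 2 letters) embraces a  iff  O(b) < a < C(b)
  -- (C(b) = leftmost letter, O(b) = rightmost letter)
  embraces : List (Letter k) → Letter k → Bool
  embraces [] a = false
  embraces (c ∷ []) a = false
  embraces (c ∷ y ∷ ys) a = (lastOf y ys <L a) ∧ (a <L c)

  -- role of the letter at index i (0-based) in a block of length len ≥ 1
  role : ℕ → ℕ → Position
  role 1 _ = outsider
  role _ zero = closer
  role len (suc i) = if suc (suc i) ≡ᵇ len then opener else insider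

  Quad : Set
  Quad = Letter k × ℕ × Position × ℕ

  -- quadruples for the letters of block b, given
  --   seen  : the letters of w strictly to the left of the current letter,
  --   rest  : the descent blocks strictly to the right of block b,
  --   len   : the length of b,  i : index of the current letter in b.
  blockQuads : List (Letter k) → ℕ → ℕ → List (Letter k) → List (List (Letter k)) → List Quad
  blockQuads seen len i [] rest = []
  blockQuads seen len i (a ∷ as) rest =
    (a , occ a (seen ++ (a ∷ [])) , role len i , countB (λ B → embraces B a) rest)
      ∷ blockQuads (seen ++ (a ∷ [])) len (suc i) as rest

  δ-go : List (Letter k) → List (List (Letter k)) → List Quad
  δ-go seen [] = []
  δ-go seen (b ∷ bs) = blockQuads seen (length b) 0 b bs ++ δ-go (seen ++ b) bs

  -- δ(w), listed; it is regarded as a set (see _≋_).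
  δ : List (Letter k) → List Quad
  δ w = δ-go [] (descentBlocks w)

  _≋_ : List Quad → List Quad → Set
  s ≋ t = ∀ q → (q ∈ s) ⇔ (q ∈ t)

  InL : (Letter k → ℕ) → List Quad → Set
  InL m s = ∃ λ w → InS m w × (δ w ≋ s)

-- Rebuild w letter by letter in increasing order. At stage (c, e) the skeleton of w keeps the letters below c and
-- the first e copies of c, turns every other letter into a gap, merges runs of gaps and drops a final gap. The next
-- copy y of c goes into a gap of the skeleton: its role says whether a gap survives right before and right after it,
-- and it is placed so that r(y) + e′ gaps lie to its right, where e′ counts the later copies of y that are closers.
-- Indeed, to the right of y a gap followed by a smaller letter sits in a descent block that starts at or above y and
-- ends below y, so that block either embraces y or is closed by a copy of y. A letter together with its duplicate
-- index pins down one occurrence, so δ(w) = δ(v) supplies the same data for w and v; hence their skeletons agree at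
-- every stage, and the last skeleton is the word itself.

module Submission where

open import Defs
open import Data.Nat using (ℕ; zero; suc; _+_; _≤_; _<_; _<ᵇ_; _≡ᵇ_; s≤s; z<s)
open import Data.Nat.Properties
open import Algebra.Properties.CommutativeSemigroup +-commutativeSemigroup using (interchange)
open import Data.Bool using (Bool; true; false; if_then_else_; _∧_; not; T)
open import Data.Bool.Properties using (T-≡; ∧-zeroʳ)
open import Data.Empty using (⊥; ⊥-elim)
open import Data.Fin using (Fin; toℕ; fromℕ<)
open import Data.Fin.Properties using (toℕ-injective; toℕ-fromℕ<; toℕ<n)
open import Data.List using (List; []; _∷_; _++_; [_]; length; drop; map)
open import Data.List.Properties using (++-assoc; ++-identityʳ; length-++; ∷-injective; ∷-injectiveʳ; map-++; map-injective)
open import Data.List.Membership.Propositional using (_∈_)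
open import Data.List.Relation.Unary.Any using (here; there)
open import Data.Maybe using (Maybe; just; nothing)
open import Data.Maybe.Properties using (just-injective)
open import Data.Product using (_×_; _,_; ∃; Σ-syntax; proj₁; proj₂)
open import Data.Sum using (_⊎_; inj₁; inj₂)
open import Data.Unit using (⊤; tt)
open import Function using (_∘_)
open import Function.Bundles using (Equivalence)
open import Relation.Binary.Definitions using (tri<; tri≈; tri>)
open import Relation.Binary.PropositionalEquality hiding ([_])

≡⇒≡ᵇ≡true : ∀ {m n} → m ≡ n → (m ≡ᵇ n) ≡ true
≡⇒≡ᵇ≡true {m} {n} e = Equivalence.to T-≡ (≡⇒≡ᵇ m n e)

≡ᵇ≡true⇒≡ : ∀ m n → (m ≡ᵇ n) ≡ true → m ≡ n
≡ᵇ≡true⇒≡ m n e = ≡ᵇ⇒≡ m n (Equivalence.from T-≡ e)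

≢⇒≡ᵇ≡false : ∀ {m n} → m ≢ n → (m ≡ᵇ n) ≡ false
≢⇒≡ᵇ≡false {m} {n} m≢n with m ≡ᵇ n in eq
... | false = refl
... | true = ⊥-elim (m≢n (≡ᵇ≡true⇒≡ m n eq))

<⇒<ᵇ≡true : ∀ {m n} → m < n → (m <ᵇ n) ≡ true
<⇒<ᵇ≡true m<n = Equivalence.to T-≡ (<⇒<ᵇ m<n)

<ᵇ≡true⇒< : ∀ m n → (m <ᵇ n) ≡ true → m < n
<ᵇ≡true⇒< m n e = <ᵇ⇒< m n (Equivalence.from T-≡ e)

≥⇒<ᵇ≡false : ∀ {m n} → n ≤ m → (m <ᵇ n) ≡ false
≥⇒<ᵇ≡false {m} {n} n≤m with m <ᵇ n in eq
... | false = refl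
... | true = ⊥-elim (<⇒≱ (<ᵇ≡true⇒< m n eq) n≤m)

<ᵇ≡false⇒≥ : ∀ m n → (m <ᵇ n) ≡ false → n ≤ m
<ᵇ≡false⇒≥ m n e = ≮⇒≥ (λ m<n → subst T e (<⇒<ᵇ m<n))

bit : Bool → ℕ
bit true = 1
bit false = 0

module _ {k : ℕ} where

  countB-++ : ∀ {X : Set} (p : X → Bool) xs ys →
              countB {k} p (xs ++ ys) ≡ countB {k} p xs + countB {k} p ys
  countB-++ p [] ys = refl
  countB-++ p (x ∷ xs) ys with p x
  ... | true = cong suc (countB-++ p xs ys)
  ... | false = countB-++ p xs ys

  countB-∷ : ∀ {X : Set} (p : X → Bool) x xs → countB {k} p (x ∷ xs) ≡ bit (p x) + countB {k} p xs
  countB-∷ p x xs with p x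
  ... | true = refl
  ... | false = refl

  =L-refl : ∀ (y : Fin k) → (y =L y) ≡ true
  =L-refl y = ≡⇒≡ᵇ≡true {toℕ y} refl

  =L⇒≡ : ∀ (x y : Fin k) → (x =L y) ≡ true → x ≡ y
  =L⇒≡ x y e = toℕ-injective (≡ᵇ≡true⇒≡ (toℕ x) (toℕ y) e)

  <L⇒< : ∀ {x y : Fin k} → (x <L y) ≡ true → toℕ x < toℕ y
  <L⇒< {x} {y} = <ᵇ≡true⇒< (toℕ x) (toℕ y)

  occ-∷-self : ∀ (y : Fin k) α → occ y (y ∷ α) ≡ suc (occ y α)
  occ-∷-self y α rewrite =L-refl y = refl

  occ-∷ʳ-self : ∀ (y : Fin k) α → occ y (α ++ [ y ]) ≡ suc (occ y α)
  occ-∷ʳ-self y α rewrite countB-++ (_=L y) α [ y ] | =L-refl y = +-comm (occ y α) 1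

  occ-++-∷ : ∀ (y : Fin k) α γ → occ y (α ++ y ∷ γ) ≡ occ y α + suc (occ y γ)
  occ-++-∷ y α γ rewrite countB-++ (_=L y) α (y ∷ γ) = cong (occ y α +_) (occ-∷-self y γ)

  -- Quadruples computed letter by letter

  lastOr : Maybe (Fin k) → List (Fin k) → Maybe (Fin k)
  lastOr p [] = p
  lastOr p (x ∷ xs) = lastOr (just x) xs

  lastOr-++ : ∀ p xs ys → lastOr p (xs ++ ys) ≡ lastOr (lastOr p xs) ys
  lastOr-++ p [] ys = refl
  lastOr-++ p (x ∷ xs) ys = lastOr-++ (just x) xs ys

  lastOr-∷ʳ : ∀ p xs a → lastOr p (xs ++ [ a ]) ≡ just a
  lastOr-∷ʳ p xs a = lastOr-++ p xs [ a ]

  lastOr-∷ : ∀ p z d → lastOr p (z ∷ d) ≡ just (lastOf z d)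
  lastOr-∷ p z [] = refl
  lastOr-∷ p z (h ∷ d) = lastOr-∷ p h d

  -- The first argument is the letter just before y, if any.
  startsBlock : Maybe (Fin k) → Fin k → Bool
  startsBlock nothing y = true
  startsBlock (just z) y = not (y <L z)

  continuesBlock : Fin k → List (Fin k) → Bool
  continuesBlock y [] = false
  continuesBlock y (h ∷ _) = h <L y

  roleOf : (starts continues : Bool) → Position {k}
  roleOf true true = closer
  roleOf true false = outsider
  roleOf false true = insider
  roleOf false false = opener

  localRole : Maybe (Fin k) → Fin k → List (Fin k) → Position {k}
  localRole p y β = roleOf (startsBlock p y) (continuesBlock y β)

  embracing : Fin k → List (List (Fin k)) → ℕ
  embracing y = countB {k} (λ B → embraces B y)

  rightEmbracing : Fin k → List (Fin k) → ℕ
  rightEmbracing y β = embracing y (drop 1 (blocksFrom y β))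

  quadAt : List (Fin k) → Fin k → List (Fin k) → Quad {k}
  quadAt α y β = (y , occ y (α ++ [ y ]) , localRole (lastOr nothing α) y β , rightEmbracing y β)

  quads : List (Fin k) → List (Fin k) → List (Quad {k})
  quads α [] = []
  quads α (a ∷ β) = quadAt α a β ∷ quads (α ++ [ a ]) β

  quadsAlong : List (Fin k) → List (Fin k) → List (Fin k) → List (Quad {k})
  quadsAlong α [] s = []
  quadsAlong α (a ∷ u) s = quadAt α a (u ++ s) ∷ quadsAlong (α ++ [ a ]) u s

  quads-++ : ∀ α u s → quads α (u ++ s) ≡ quadsAlong α u s ++ quads (α ++ u) s
  quads-++ α [] s = cong (λ γ → quads γ s) (sym (++-identityʳ α))
  quads-++ α (a ∷ u) s = cong (quadAt α a (u ++ s) ∷_) (begin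
    quads (α ++ [ a ]) (u ++ s)
      ≡⟨ quads-++ (α ++ [ a ]) u s ⟩
    quadsAlong (α ++ [ a ]) u s ++ quads ((α ++ [ a ]) ++ u) s
      ≡⟨ cong (λ γ → quadsAlong (α ++ [ a ]) u s ++ quads γ s) (++-assoc α [ a ] u) ⟩
    quadsAlong (α ++ [ a ]) u s ++ quads (α ++ a ∷ u) s ∎)
    where open ≡-Reasoning

  Descending : Fin k → List (Fin k) → Set
  Descending z [] = ⊤
  Descending z (h ∷ d) = ((h <L z) ≡ true) × Descending h d

  Breaks : Fin k → List (Fin k) → Set
  Breaks z [] = ⊤
  Breaks z (h ∷ _) = (h <L z) ≡ false

  BlockStartAt : Maybe (Fin k) → List (Fin k) → Set
  BlockStartAt p [] = ⊤
  BlockStartAt p (h ∷ _) = startsBlock p h ≡ true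

  breaks⇒blockStartAt : ∀ {z} s → Breaks z s → BlockStartAt (just z) s
  breaks⇒blockStartAt [] _ = tt
  breaks⇒blockStartAt (h ∷ _) brk = cong not brk

  blocksFrom-++ : ∀ z d s → Descending z d → Breaks (lastOf z d) s →
                  blocksFrom z (d ++ s) ≡ (z ∷ d) ∷ descentBlocks s
  blocksFrom-++ z [] [] _ _ = refl
  blocksFrom-++ z [] (h ∷ t) _ brk rewrite brk = refl
  blocksFrom-++ z (h ∷ d) s (h<z , desc) brk rewrite h<z | blocksFrom-++ h d s desc brk = refl

  continuesBlock-++ : ∀ z d s → Descending z d → Breaks (lastOf z d) s →
                      continuesBlock z (d ++ s) ≡ (0 <ᵇ length d)
  continuesBlock-++ z [] [] _ _ = refl
  continuesBlock-++ z [] (h ∷ t) _ brk = brk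
  continuesBlock-++ z (h ∷ d) s (h<z , _) _ = h<z

  firstBlock : ∀ z xs → Σ[ d ∈ List (Fin k) ] Σ[ s ∈ List (Fin k) ]
               (xs ≡ d ++ s) × Descending z d × Breaks (lastOf z d) s
  firstBlock z [] = [] , [] , refl , tt , tt
  firstBlock z (h ∷ t) with h <L z in h<z
  ... | false = [] , h ∷ t , refl , tt , h<z
  ... | true with firstBlock h t
  ...   | d , s , refl , desc , brk = h ∷ d , s , refl , (h<z , desc) , brk

  data BlockView : List (Fin k) → Set where
    []    : BlockView []
    block : ∀ {z d s} → Descending z d → Breaks (lastOf z d) s → BlockView s →
            BlockView (z ∷ d ++ s)

  blockView : ∀ w → BlockView w
  blockView w = go (length w) w ≤-refl
    where
    go : ∀ n w → length w ≤ n → BlockView w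
    go _ [] _ = []
    go (suc n) (z ∷ xs) (s≤s |xs|≤n) with firstBlock z xs
    ... | d , s , refl , desc , brk =
      block desc brk (go n s (≤-trans (m≤n+m (length s) (length d))
                                      (subst (_≤ n) (length-++ d) |xs|≤n)))

  role-positional : ∀ L i n → L ≡ i + suc n → role {k} L i ≡ roleOf (i ≡ᵇ 0) (0 <ᵇ n)
  role-positional .1 zero zero refl = refl
  role-positional .(suc (suc n)) zero (suc n) refl = refl
  role-positional L (suc j) n refl rewrite +-suc j n = lemma n
    where
    lemma : ∀ n → role {k} (suc (suc (j + n))) (suc j) ≡ roleOf false (0 <ᵇ n)
    lemma zero rewrite +-identityʳ j | ≡⇒≡ᵇ≡true {j} refl = refl
    lemma (suc n) rewrite ≢⇒≡ᵇ≡false {j} {j + suc n} (λ e → <-irrefl e (m<m+n j z<s)) = refl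

  blockQuads≡quadsAlong : ∀ α L i z d s → L ≡ i + suc (length d) →
    Descending z d → Breaks (lastOf z d) s → startsBlock (lastOr nothing α) z ≡ (i ≡ᵇ 0) →
    blockQuads α L i (z ∷ d) (descentBlocks s) ≡ quadsAlong α (z ∷ d) s
  blockQuads≡quadsAlong α L i z d s L≡ desc brk start = cong₂ _∷_ head (rest d desc brk L≡)
    where
    roleEq : role L i ≡ localRole (lastOr nothing α) z (d ++ s)
    roleEq rewrite role-positional L i (length d) L≡ | start | continuesBlock-++ z d s desc brk = refl
    embracingEq : embracing z (descentBlocks s) ≡ rightEmbracing z (d ++ s)
    embracingEq rewrite blocksFrom-++ z d s desc brk = refl
    head : _≡_ {A = Quad {k}} (z , occ z (α ++ [ z ]) , role L i , embracing z (descentBlocks s))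
                                (quadAt α z (d ++ s))
    head rewrite roleEq | embracingEq = refl
    rest : ∀ d → Descending z d → Breaks (lastOf z d) s → L ≡ i + suc (length d) →
           blockQuads (α ++ [ z ]) L (suc i) d (descentBlocks s) ≡ quadsAlong (α ++ [ z ]) d s
    rest [] _ _ _ = refl
    rest (h ∷ d) (h<z , desc) brk L≡ =
      blockQuads≡quadsAlong (α ++ [ z ]) L (suc i) h d s (trans L≡ (+-suc i (suc (length d)))) desc brk
        (trans (cong (λ p → startsBlock p h) (lastOr-∷ʳ nothing α z)) (cong not h<z))

  δ-go≡quads : ∀ {w} → BlockView w → ∀ α → BlockStartAt (lastOr nothing α) w →
               δ-go α (descentBlocks w) ≡ quads α w
  δ-go≡quads [] α _ = refl
  δ-go≡quads (block {z} {d} {s} desc brk view) α start = begin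
    δ-go α (blocksFrom z (d ++ s))
      ≡⟨ cong (δ-go α) (blocksFrom-++ z d s desc brk) ⟩
    blockQuads α (suc (length d)) 0 (z ∷ d) (descentBlocks s) ++ δ-go (α ++ z ∷ d) (descentBlocks s)
      ≡⟨ cong₂ _++_ (blockQuads≡quadsAlong α _ 0 z d s refl desc brk start)
                    (δ-go≡quads view (α ++ z ∷ d) startAfter) ⟩
    quadsAlong α (z ∷ d) s ++ quads (α ++ z ∷ d) s
      ≡⟨ sym (quads-++ α (z ∷ d) s) ⟩
    quads α (z ∷ d ++ s) ∎
    where
    open ≡-Reasoning
    startAfter : BlockStartAt (lastOr nothing (α ++ z ∷ d)) s
    startAfter rewrite lastOr-++ nothing α (z ∷ d) | lastOr-∷ (lastOr nothing α) z d = breaks⇒blockStartAt s brk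

  δ≡quads : ∀ w → δ w ≡ quads [] w
  δ≡quads [] = refl
  δ≡quads w@(_ ∷ _) = δ-go≡quads (blockView w) [] refl

  ∈-quads⇒split : ∀ α w {q} → q ∈ quads α w →
    ∃ λ α₁ → ∃ λ a → ∃ λ β → (w ≡ α₁ ++ a ∷ β) × (q ≡ quadAt (α ++ α₁) a β)
  ∈-quads⇒split α (a ∷ β) (here q≡) =
    [] , a , β , refl , trans q≡ (cong (λ γ → quadAt γ a β) (sym (++-identityʳ α)))
  ∈-quads⇒split α (a ∷ β) (there q∈) with ∈-quads⇒split (α ++ [ a ]) β q∈
  ... | α₁ , b , γ , refl , q≡ =
    a ∷ α₁ , b , γ , refl , trans q≡ (cong (λ α′ → quadAt α′ b γ) (++-assoc α [ a ] α₁))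

  quadAt∈quads : ∀ α α₁ a β → quadAt (α ++ α₁) a β ∈ quads α (α₁ ++ a ∷ β)
  quadAt∈quads α [] a β = here (cong (λ γ → quadAt γ a β) (++-identityʳ α))
  quadAt∈quads α (b ∷ α₁) a β =
    there (subst (λ γ → quadAt γ a β ∈ quads (α ++ [ b ]) (α₁ ++ a ∷ β)) (++-assoc α [ b ] α₁)
                 (quadAt∈quads (α ++ [ b ]) α₁ a β))

  occ-∷-cancel : ∀ (y z : Fin k) α α' → occ y (z ∷ α) ≡ occ y (z ∷ α') → occ y α ≡ occ y α'
  occ-∷-cancel y z α α' e with z =L y
  ... | true = suc-injective e
  ... | false = e

  split-unique : ∀ (y : Fin k) α β α' β' → α ++ y ∷ β ≡ α' ++ y ∷ β' → occ y α ≡ occ y α' →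
                 α ≡ α' × β ≡ β'
  split-unique y [] β [] β' e _ = refl , ∷-injectiveʳ e
  split-unique y [] β (z ∷ α') β' refl o = ⊥-elim (0≢1+n (trans o (occ-∷-self y α')))
  split-unique y (z ∷ α) β [] β' refl o = ⊥-elim (1+n≢0 (trans (sym (occ-∷-self y α)) o))
  split-unique y (z ∷ α) β (z′ ∷ α') β' e o with ∷-injective e
  ... | refl , e′ with split-unique y α β α' β' e′ (occ-∷-cancel y z α α' o)
  ...   | refl , refl = refl , refl

  quadAt∈δ : ∀ α y β → quadAt α y β ∈ δ (α ++ y ∷ β)
  quadAt∈δ α y β = subst (quadAt α y β ∈_) (sym (δ≡quads (α ++ y ∷ β))) (quadAt∈quads [] α y β)

  ∈δ⇒split : ∀ w {q} → q ∈ δ w → ∃ λ α → ∃ λ a → ∃ λ β → (w ≡ α ++ a ∷ β) × (q ≡ quadAt α a β)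
  ∈δ⇒split w q∈ = ∈-quads⇒split [] w (subst (_ ∈_) (δ≡quads w) q∈)

  quadAt-agree : ∀ {w v} → δ w ≋ δ v → ∀ {α y β α' β'} → w ≡ α ++ y ∷ β → v ≡ α' ++ y ∷ β' →
                 occ y α ≡ occ y α' → quadAt α y β ≡ quadAt α' y β'
  quadAt-agree {w} {v} δw≋δv {α} {y} {β} {α'} {β'} refl refl o
    with ∈δ⇒split v (Equivalence.to (δw≋δv (quadAt α y β)) (quadAt∈δ α y β))
  ... | α₃ , a₃ , β₃ , v≡ , q≡ with cong proj₁ q≡
  ... | refl with split-unique y α₃ β₃ α' β' (sym v≡) (trans (index≡ (cong (proj₁ ∘ proj₂) q≡)) o)
    where
    index≡ : occ y (α ++ [ y ]) ≡ occ y (α₃ ++ [ y ]) → occ y α₃ ≡ occ y α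
    index≡ e = suc-injective (trans (sym (occ-∷ʳ-self y α₃)) (trans (sym e) (occ-∷ʳ-self y α)))
  ...   | refl , refl = q≡

  -- Gapped words, where nothing marks a gap

  Gapped : Set
  Gapped = List (Maybe (Fin k))

  -- Merges every run of gaps into one; the flag records that a gap was just emitted.
  collapse : Bool → Gapped → Gapped
  collapse b [] = []
  collapse b (just x ∷ xs) = just x ∷ collapse false xs
  collapse true (nothing ∷ xs) = collapse true xs
  collapse false (nothing ∷ xs) = nothing ∷ collapse true xs

  endsInGap : Bool → Gapped → Bool
  endsInGap b [] = b
  endsInGap b (just _ ∷ xs) = endsInGap false xs
  endsInGap b (nothing ∷ xs) = endsInGap true xs

  collapse-++ : ∀ b A T → collapse b (A ++ T) ≡ collapse b A ++ collapse (endsInGap b A) T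
  collapse-++ b [] T = refl
  collapse-++ b (just x ∷ A) T = cong (just x ∷_) (collapse-++ false A T)
  collapse-++ true (nothing ∷ A) T = collapse-++ true A T
  collapse-++ false (nothing ∷ A) T = cong (nothing ∷_) (collapse-++ true A T)

  consGap : Gapped → Gapped
  consGap [] = []
  consGap xs@(_ ∷ _) = nothing ∷ xs

  dropTrailingGaps : Gapped → Gapped
  dropTrailingGaps [] = []
  dropTrailingGaps (just x ∷ xs) = just x ∷ dropTrailingGaps xs
  dropTrailingGaps (nothing ∷ xs) = consGap (dropTrailingGaps xs)

  AllGaps : Gapped → Set
  AllGaps [] = ⊤
  AllGaps (just _ ∷ _) = ⊥
  AllGaps (nothing ∷ xs) = AllGaps xs

  HasLetter : Gapped → Set
  HasLetter [] = ⊥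
  HasLetter (just _ ∷ _) = ⊤
  HasLetter (nothing ∷ xs) = HasLetter xs

  allGaps⊎hasLetter : ∀ B → AllGaps B ⊎ HasLetter B
  allGaps⊎hasLetter [] = inj₁ tt
  allGaps⊎hasLetter (just x ∷ B) = inj₂ tt
  allGaps⊎hasLetter (nothing ∷ B) = allGaps⊎hasLetter B

  startsWithLetter : Gapped → Bool
  startsWithLetter (just _ ∷ _) = true
  startsWithLetter _ = false

  innerGaps : Gapped → ℕ
  innerGaps [] = 0
  innerGaps (just _ ∷ xs) = innerGaps xs
  innerGaps (nothing ∷ xs) = bit (startsWithLetter xs) + innerGaps xs

  dropTrailingGaps-allGaps : ∀ Y → AllGaps Y → dropTrailingGaps Y ≡ []
  dropTrailingGaps-allGaps [] _ = refl
  dropTrailingGaps-allGaps (nothing ∷ Y) all = cong consGap (dropTrailingGaps-allGaps Y all)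

  dropTrailingGaps-++-allGaps : ∀ X Y → AllGaps Y → dropTrailingGaps (X ++ Y) ≡ dropTrailingGaps X
  dropTrailingGaps-++-allGaps [] Y all = dropTrailingGaps-allGaps Y all
  dropTrailingGaps-++-allGaps (just x ∷ X) Y all = cong (just x ∷_) (dropTrailingGaps-++-allGaps X Y all)
  dropTrailingGaps-++-allGaps (nothing ∷ X) Y all = cong consGap (dropTrailingGaps-++-allGaps X Y all)

  dropTrailingGaps-hasLetter : ∀ Y → HasLetter Y → ∃ λ z → ∃ λ zs → dropTrailingGaps Y ≡ z ∷ zs
  dropTrailingGaps-hasLetter (just x ∷ Y) _ = just x , dropTrailingGaps Y , refl
  dropTrailingGaps-hasLetter (nothing ∷ Y) has with dropTrailingGaps-hasLetter Y has
  ... | z , zs , e = nothing , z ∷ zs , cong consGap e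

  dropTrailingGaps-++-hasLetter : ∀ X Y → HasLetter Y → dropTrailingGaps (X ++ Y) ≡ X ++ dropTrailingGaps Y
  dropTrailingGaps-++-hasLetter [] Y has = refl
  dropTrailingGaps-++-hasLetter (just x ∷ X) Y has = cong (just x ∷_) (dropTrailingGaps-++-hasLetter X Y has)
  dropTrailingGaps-++-hasLetter (nothing ∷ []) Y has with dropTrailingGaps-hasLetter Y has
  ... | z , zs , e rewrite e = refl
  dropTrailingGaps-++-hasLetter (nothing ∷ X@(_ ∷ _)) Y has =
    cong consGap (dropTrailingGaps-++-hasLetter X Y has)

  startsWithLetter-dropTrailingGaps : ∀ X → startsWithLetter (dropTrailingGaps X) ≡ startsWithLetter X
  startsWithLetter-dropTrailingGaps [] = refl
  startsWithLetter-dropTrailingGaps (just x ∷ X) = refl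
  startsWithLetter-dropTrailingGaps (nothing ∷ X) with dropTrailingGaps X
  ... | [] = refl
  ... | _ ∷ _ = refl

  innerGaps-dropTrailingGaps : ∀ X → innerGaps (dropTrailingGaps X) ≡ innerGaps X
  innerGaps-dropTrailingGaps [] = refl
  innerGaps-dropTrailingGaps (just x ∷ X) = innerGaps-dropTrailingGaps X
  innerGaps-dropTrailingGaps (nothing ∷ X)
    rewrite sym (startsWithLetter-dropTrailingGaps X) | sym (innerGaps-dropTrailingGaps X)
    with dropTrailingGaps X
  ... | [] = refl
  ... | _ ∷ _ = refl

  innerGaps-collapse : ∀ B → innerGaps (collapse false B) ≡ innerGaps B
                           × innerGaps (nothing ∷ collapse true B) ≡ innerGaps (nothing ∷ B)
  innerGaps-collapse [] = refl , refl
  innerGaps-collapse (just x ∷ B) = proj₁ (innerGaps-collapse B) , cong suc (proj₁ (innerGaps-collapse B))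
  innerGaps-collapse (nothing ∷ B) = proj₂ (innerGaps-collapse B) , proj₂ (innerGaps-collapse B)

  innerGaps-++ʳ : ∀ X Y → innerGaps Y ≤ innerGaps (X ++ Y)
  innerGaps-++ʳ [] Y = ≤-refl
  innerGaps-++ʳ (just x ∷ X) Y = innerGaps-++ʳ X Y
  innerGaps-++ʳ (nothing ∷ X) Y = ≤-trans (innerGaps-++ʳ X Y) (m≤n+m _ _)

  allGaps⇒startsWithLetter≡false : ∀ B → AllGaps B → startsWithLetter B ≡ false
  allGaps⇒startsWithLetter≡false [] _ = refl
  allGaps⇒startsWithLetter≡false (nothing ∷ B) _ = refl

  allGaps⇒innerGaps≡0 : ∀ B → AllGaps B → innerGaps B ≡ 0
  allGaps⇒innerGaps≡0 [] _ = refl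
  allGaps⇒innerGaps≡0 (nothing ∷ B) all
    rewrite allGaps⇒startsWithLetter≡false B all = allGaps⇒innerGaps≡0 B all

  collapse-allGaps : ∀ B → AllGaps B → collapse true B ≡ []
  collapse-allGaps [] _ = refl
  collapse-allGaps (nothing ∷ B) all = collapse-allGaps B all

  allGaps-collapse : ∀ B → AllGaps B → AllGaps (collapse false B)
  allGaps-collapse [] _ = tt
  allGaps-collapse (nothing ∷ B) all rewrite collapse-allGaps B all = tt

  gapIf : Bool → Gapped
  gapIf true = [ nothing ]
  gapIf false = []

  collapse-split : ∀ b A → ∃ λ N → (gapIf b ++ collapse b A ≡ N ++ gapIf (endsInGap b A))
                                  × dropTrailingGaps N ≡ N
  collapse-split b [] = [] , ++-identityʳ _ , refl
  collapse-split true (nothing ∷ A) = collapse-split true A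
  collapse-split false (nothing ∷ A) = collapse-split true A
  collapse-split b (just x ∷ A) with collapse-split false A | b
  ... | N , e , trim | true =
    nothing ∷ just x ∷ N , cong (λ z → nothing ∷ just x ∷ z) e , cong (λ z → nothing ∷ just x ∷ z) trim
  ... | N , e , trim | false = just x ∷ N , cong (just x ∷_) e , cong (just x ∷_) trim

  fillGap : Gapped → ℕ → Gapped → Gapped
  fillGap [] j P = []
  fillGap (just x ∷ xs) j P = just x ∷ fillGap xs j P
  fillGap (nothing ∷ xs) j P = if innerGaps xs ≡ᵇ j then P ++ xs else nothing ∷ fillGap xs j P

  innerGaps-gap∷ : ∀ Q → startsWithLetter Q ≡ true → innerGaps (nothing ∷ Q) ≡ suc (innerGaps Q)
  innerGaps-gap∷ Q sw rewrite sw = refl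

  fillGap-at : ∀ N Q P → startsWithLetter Q ≡ true →
               fillGap (N ++ nothing ∷ Q) (innerGaps Q) P ≡ N ++ P ++ Q
  fillGap-at [] Q P _ rewrite ≡⇒≡ᵇ≡true {innerGaps Q} refl = refl
  fillGap-at (just x ∷ N) Q P sw = cong (just x ∷_) (fillGap-at N Q P sw)
  fillGap-at (nothing ∷ N) Q P sw
    rewrite ≢⇒≡ᵇ≡false {innerGaps (N ++ nothing ∷ Q)} (λ e → <-irrefl (sym e)
              (≤-trans (≤-reflexive (sym (innerGaps-gap∷ Q sw))) (innerGaps-++ʳ N (nothing ∷ Q))))
    = cong (nothing ∷_) (fillGap-at N Q P sw)

  -- Inserts the letter y so that r inner gaps lie to its right; a gap stays right before y
  -- unless y starts a block, and right after y unless its block continues.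
  insertLetter : Gapped → Fin k → Position {k} → ℕ → Gapped
  insertLetter u y closer r = fillGap u r [ just y ]
  insertLetter u y insider r = fillGap u r (nothing ∷ just y ∷ [])
  insertLetter u y outsider zero = u ++ [ just y ]
  insertLetter u y outsider (suc r) = fillGap u r (just y ∷ nothing ∷ [])
  insertLetter u y opener zero = u ++ nothing ∷ just y ∷ []
  insertLetter u y opener (suc r) = fillGap u r (nothing ∷ just y ∷ nothing ∷ [])

  hasLetter-++ : ∀ P x R → HasLetter (P ++ just x ∷ R)
  hasLetter-++ [] x R = tt
  hasLetter-++ (just _ ∷ P) x R = tt
  hasLetter-++ (nothing ∷ P) x R = hasLetter-++ P x R

  dropTrailingGaps-around : ∀ N P z R →
    dropTrailingGaps (N ++ P ++ just z ∷ R) ≡ N ++ P ++ just z ∷ dropTrailingGaps R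
  dropTrailingGaps-around N P z R
    rewrite dropTrailingGaps-++-hasLetter N (P ++ just z ∷ R) (hasLetter-++ P z R)
          | dropTrailingGaps-++-hasLetter P (just z ∷ R) tt = refl

  dropTrailingGaps-fillGap : ∀ N P z R →
    dropTrailingGaps (N ++ P ++ just z ∷ R) ≡ fillGap (N ++ nothing ∷ just z ∷ dropTrailingGaps R) (innerGaps R) P
  dropTrailingGaps-fillGap N P z R
    rewrite dropTrailingGaps-around N P z R | sym (innerGaps-dropTrailingGaps R) =
    sym (fillGap-at N (just z ∷ dropTrailingGaps R) P refl)

  insertLetter-end : ∀ u y cut → insertLetter u y (roleOf cut false) 0 ≡ u ++ gapIf (not cut) ++ [ just y ]
  insertLetter-end u y true = refl
  insertLetter-end u y false = refl

  insertLetter-fillGap : ∀ u y cut cont r →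
    insertLetter u y (roleOf cut cont) (bit (not cont) + r)
      ≡ fillGap u r (gapIf (not cut) ++ just y ∷ gapIf (not cont))
  insertLetter-fillGap u y true true r = refl
  insertLetter-fillGap u y true false r = refl
  insertLetter-fillGap u y false true r = refl
  insertLetter-fillGap u y false false r = refl

  collapse-hasLetter : ∀ B → HasLetter B → ∃ λ z → ∃ λ R →
    (collapse true B ≡ just z ∷ R) × (collapse false B ≡ gapIf (not (startsWithLetter B)) ++ just z ∷ R)
  collapse-hasLetter (just x ∷ B) _ = x , collapse false B , refl , refl
  collapse-hasLetter (nothing ∷ B) has with collapse-hasLetter B has
  ... | z , R , e , _ = z , R , e , cong (nothing ∷_) e

  innerGaps-gapIf : ∀ b z R → innerGaps (gapIf b ++ just z ∷ R) ≡ bit b + innerGaps R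
  innerGaps-gapIf true z R = refl
  innerGaps-gapIf false z R = refl

  insertLetter-collapsed : ∀ N B y cut → dropTrailingGaps N ≡ N →
    dropTrailingGaps (N ++ gapIf (not cut) ++ just y ∷ collapse false B)
      ≡ insertLetter (dropTrailingGaps (N ++ nothing ∷ collapse true B)) y
                     (roleOf cut (startsWithLetter B)) (innerGaps B)
  insertLetter-collapsed N B y cut trim with allGaps⊎hasLetter B
  ... | inj₁ all
    rewrite allGaps⇒startsWithLetter≡false B all | collapse-allGaps B all | allGaps⇒innerGaps≡0 B all
          | dropTrailingGaps-++-allGaps N [ nothing ] tt | trim
          | dropTrailingGaps-around N (gapIf (not cut)) y (collapse false B)
          | dropTrailingGaps-allGaps (collapse false B) (allGaps-collapse B all) =
    sym (insertLetter-end N y cut)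
  ... | inj₂ has with collapse-hasLetter B has
  ...   | z , R , eT , eF
    rewrite sym (proj₁ (innerGaps-collapse B)) | eT | eF | innerGaps-gapIf (not (startsWithLetter B)) z R
          | dropTrailingGaps-around N [ nothing ] z R
          | sym (++-assoc (gapIf (not cut)) (just y ∷ gapIf (not (startsWithLetter B))) (just z ∷ R))
          | dropTrailingGaps-fillGap N (gapIf (not cut) ++ just y ∷ gapIf (not (startsWithLetter B))) z R =
    sym (insertLetter-fillGap _ y cut (startsWithLetter B) (innerGaps R))

  gapIf-collapse : ∀ b B → gapIf b ++ collapse b (nothing ∷ B) ≡ nothing ∷ collapse true B
  gapIf-collapse true B = refl
  gapIf-collapse false B = refl

  normalize : Gapped → Gapped
  normalize u = dropTrailingGaps (collapse false u)

  normalize-fill : ∀ A B y cut → endsInGap false A ≡ not cut →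
    normalize (A ++ just y ∷ B)
      ≡ insertLetter (normalize (A ++ nothing ∷ B)) y (roleOf cut (startsWithLetter B)) (innerGaps B)
  normalize-fill A B y cut ends with collapse-split false A
  ... | N , e , trim
    rewrite collapse-++ false A (just y ∷ B) | collapse-++ false A (nothing ∷ B) | e | ends
          | ++-assoc N (gapIf (not cut)) (just y ∷ collapse false B)
          | ++-assoc N (gapIf (not cut)) (collapse (not cut) (nothing ∷ B)) | gapIf-collapse (not cut) B =
    insertLetter-collapsed N B y cut trim

  -- Skeletons

  mutual
    partialWord : ℕ → ℕ → List (Fin k) → Gapped
    partialWord c e [] = []
    partialWord c e (x ∷ xs) = partialWord∷ c e x xs (toℕ x <ᵇ c) (toℕ x ≡ᵇ c)

    partialWord∷ : ℕ → ℕ → Fin k → List (Fin k) → (below equal : Bool) → Gapped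
    partialWord∷ c e x xs true _ = just x ∷ partialWord c e xs
    partialWord∷ c e x xs false false = nothing ∷ partialWord c e xs
    partialWord∷ c zero x xs false true = nothing ∷ partialWord c zero xs
    partialWord∷ c (suc e) x xs false true = just x ∷ partialWord c e xs

  skeleton : ℕ → ℕ → List (Fin k) → Gapped
  skeleton c e w = normalize (partialWord c e w)

  maskAbove : ℕ → Fin k → Maybe (Fin k)
  maskAbove c x = if c <ᵇ toℕ x then nothing else just x

  maskFrom : ℕ → Fin k → Maybe (Fin k)
  maskFrom c x = if toℕ x <ᵇ c then just x else nothing

  partialWord-++ : ∀ y e α T →
    partialWord (toℕ y) (e + occ y α) (α ++ T)
      ≡ map (maskAbove (toℕ y)) α ++ partialWord (toℕ y) e T
  partialWord-++ y e [] T = cong (λ n → partialWord (toℕ y) n T) (+-identityʳ e)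
  partialWord-++ y e (x ∷ α) T with <-cmp (toℕ x) (toℕ y)
  ... | tri< x<y x≢y _
    rewrite <⇒<ᵇ≡true x<y | ≢⇒≡ᵇ≡false x≢y | ≥⇒<ᵇ≡false (<⇒≤ x<y) = cong (just x ∷_) (partialWord-++ y e α T)
  ... | tri≈ _ x≡y _
    rewrite ≥⇒<ᵇ≡false (≤-reflexive (sym x≡y)) | ≡⇒≡ᵇ≡true x≡y | ≥⇒<ᵇ≡false (≤-reflexive x≡y)
          | +-suc e (occ y α) =
    cong (just x ∷_) (partialWord-++ y e α T)
  ... | tri> _ x≢y x>y
    rewrite ≥⇒<ᵇ≡false (<⇒≤ x>y) | ≢⇒≡ᵇ≡false x≢y | <⇒<ᵇ≡true x>y = cong (nothing ∷_) (partialWord-++ y e α T)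

  partialWord-exhausted : ∀ c β → partialWord c 0 β ≡ map (maskFrom c) β
  partialWord-exhausted c [] = refl
  partialWord-exhausted c (x ∷ β) with toℕ x <ᵇ c | toℕ x ≡ᵇ c
  ... | true | _ = cong (just x ∷_) (partialWord-exhausted c β)
  ... | false | true = cong (nothing ∷_) (partialWord-exhausted c β)
  ... | false | false = cong (nothing ∷_) (partialWord-exhausted c β)

  partialWord-at : ∀ y α β b →
    partialWord (toℕ y) (bit b + occ y α) (α ++ y ∷ β)
      ≡ map (maskAbove (toℕ y)) α ++ (if b then just y else nothing) ∷ map (maskFrom (toℕ y)) β
  partialWord-at y α β b
    rewrite partialWord-++ y (bit b) α (y ∷ β) | ≥⇒<ᵇ≡false {toℕ y} ≤-refl | ≡⇒≡ᵇ≡true {toℕ y} refl =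
    cong (map (maskAbove (toℕ y)) α ++_) (lemma b)
    where
    lemma : ∀ b → partialWord∷ (toℕ y) (bit b) y β false true
                    ≡ (if b then just y else nothing) ∷ map (maskFrom (toℕ y)) β
    lemma true = cong (just y ∷_) (partialWord-exhausted (toℕ y) β)
    lemma false = cong (nothing ∷_) (partialWord-exhausted (toℕ y) β)

  endsInGap-maskAbove : ∀ y p α →
    endsInGap (not (startsBlock p y)) (map (maskAbove (toℕ y)) α) ≡ not (startsBlock (lastOr p α) y)
  endsInGap-maskAbove y p [] = refl
  endsInGap-maskAbove y p (x ∷ α) with toℕ y <ᵇ toℕ x | endsInGap-maskAbove y (just x) α
  ... | true | ih = ih
  ... | false | ih = ih

  startsWithLetter-maskFrom : ∀ y β → startsWithLetter (map (maskFrom (toℕ y)) β) ≡ continuesBlock y β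
  startsWithLetter-maskFrom y [] = refl
  startsWithLetter-maskFrom y (h ∷ t) with toℕ h <ᵇ toℕ y
  ... | true = refl
  ... | false = refl

  -- Gaps below a letter versus embracing blocks

  isCloser : Position {k} → Bool
  isCloser closer = true
  isCloser _ = false

  isCloser-roleOf : ∀ starts continues → isCloser (roleOf starts continues) ≡ starts ∧ continues
  isCloser-roleOf true true = refl
  isCloser-roleOf true false = refl
  isCloser-roleOf false true = refl
  isCloser-roleOf false false = refl

  -- The copies of y in β that are closers; p is the letter just before β.
  closerCopies : Fin k → Maybe (Fin k) → List (Fin k) → ℕ
  closerCopies y p [] = 0
  closerCopies y p (h ∷ t) = bit (isCloser (localRole p h t) ∧ (h =L y)) + closerCopies y (just h) t

  closerCopies-block : ∀ y (h : Fin k) d s → Descending h d →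
                       closerCopies y (just h) (d ++ s) ≡ closerCopies y (just (lastOf h d)) s
  closerCopies-block y h [] s _ = refl
  closerCopies-block y h (h′ ∷ d) s (h′<h , desc)
    rewrite isCloser-roleOf (startsBlock (just h) h′) (continuesBlock h′ (d ++ s)) | h′<h =
    closerCopies-block y h′ d s desc

  lastOf-≤ : ∀ (h : Fin k) d → Descending h d → toℕ (lastOf h d) ≤ toℕ h
  lastOf-≤ h [] _ = ≤-refl
  lastOf-≤ h (h′ ∷ d) (h′<h , desc) = ≤-trans (lastOf-≤ h′ d desc) (<⇒≤ (<L⇒< h′<h))

  innerGaps-maskFrom-below : ∀ c (h : Fin k) d Y → Descending h d → toℕ h < c →
                             innerGaps (map (maskFrom c) d ++ Y) ≡ innerGaps Y
  innerGaps-maskFrom-below c h [] Y _ _ = refl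
  innerGaps-maskFrom-below c h (h′ ∷ d) Y (h′<h , desc) h<c with <-trans (<L⇒< h′<h) h<c
  ... | h′<c rewrite <⇒<ᵇ≡true h′<c = innerGaps-maskFrom-below c h′ d Y desc h′<c

  -- A descending block masked from c reads gaps then letters.
  innerGaps-maskFrom-block : ∀ c (h : Fin k) d → Descending h d →
    innerGaps (map (maskFrom c) (h ∷ d)) ≡ bit ((toℕ (lastOf h d) <ᵇ c) ∧ not (toℕ h <ᵇ c))
  innerGaps-maskFrom-block c h [] _ with toℕ h <ᵇ c
  ... | true = refl
  ... | false = refl
  innerGaps-maskFrom-block c h (h′ ∷ d) (h′<h , desc) with toℕ h <ᵇ c in h<c
  ... | true = trans (innerGaps-maskFrom-block c h′ d desc)
                    (cong (λ b → bit ((toℕ (lastOf h′ d) <ᵇ c) ∧ not b))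
                          (<⇒<ᵇ≡true (<-trans (<L⇒< h′<h) (<ᵇ≡true⇒< (toℕ h) c h<c))))
  ... | false rewrite innerGaps-maskFrom-block c h′ d desc with toℕ h′ <ᵇ c in h′<c
  ...   | true = subst (λ b → suc (bit (b ∧ false)) ≡ bit (b ∧ true))
                     (sym (<⇒<ᵇ≡true (≤-<-trans (lastOf-≤ h′ d desc) (<ᵇ≡true⇒< (toℕ h′) c h′<c)))) refl
  ...   | false = refl

  startsWithLetter-∷ : ∀ (z : Maybe (Fin k)) l l′ → startsWithLetter (z ∷ l) ≡ startsWithLetter (z ∷ l′)
  startsWithLetter-∷ (just x) l l′ = refl
  startsWithLetter-∷ nothing l l′ = refl

  innerGaps-maskFrom-++ : ∀ c (h : Fin k) d s → Descending h d → Breaks (lastOf h d) s →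
    innerGaps (map (maskFrom c) (h ∷ d) ++ map (maskFrom c) s)
      ≡ innerGaps (map (maskFrom c) (h ∷ d)) + innerGaps (map (maskFrom c) s)
  innerGaps-maskFrom-++ c h [] s _ brk with toℕ h <ᵇ c in h<c
  ... | true = refl
  ... | false = cong (λ b → bit b + innerGaps (map (maskFrom c) s)) (gapFirst s brk)
    where
    gapFirst : ∀ s → Breaks h s → startsWithLetter (map (maskFrom c) s) ≡ false
    gapFirst [] _ = refl
    gapFirst (h′ ∷ _) h≤h′
      rewrite ≥⇒<ᵇ≡false {toℕ h′} {c} (≤-trans (<ᵇ≡false⇒≥ (toℕ h) c h<c) (<ᵇ≡false⇒≥ (toℕ h′) (toℕ h) h≤h′))
      = refl
  innerGaps-maskFrom-++ c h (h′ ∷ d) s (_ , desc) brk with toℕ h <ᵇ c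
  ... | true = innerGaps-maskFrom-++ c h′ d s desc brk
  ... | false = begin
    bit (startsWithLetter (H′ ∷ D ++ S)) + innerGaps (H′ ∷ D ++ S)
      ≡⟨ cong₂ _+_ (cong bit (startsWithLetter-∷ H′ (D ++ S) D)) (innerGaps-maskFrom-++ c h′ d s desc brk) ⟩
    bit (startsWithLetter (H′ ∷ D)) + (innerGaps (H′ ∷ D) + innerGaps S)
      ≡⟨ sym (+-assoc (bit (startsWithLetter (H′ ∷ D))) (innerGaps (H′ ∷ D)) (innerGaps S)) ⟩
    bit (startsWithLetter (H′ ∷ D)) + innerGaps (H′ ∷ D) + innerGaps S ∎
    where
    open ≡-Reasoning
    H′ : Maybe (Fin k)
    H′ = maskFrom c h′
    D S : Gapped
    D = map (maskFrom c) d
    S = map (maskFrom c) s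

  innerGaps-maskFrom-block≡ : ∀ y (h : Fin k) d → Descending h d →
    innerGaps (map (maskFrom (toℕ y)) (h ∷ d))
      ≡ bit (embraces (h ∷ d) y) + bit ((0 <ᵇ length d) ∧ (h =L y))
  innerGaps-maskFrom-block≡ y h [] _ with toℕ h <ᵇ toℕ y
  ... | true = refl
  ... | false = refl
  innerGaps-maskFrom-block≡ y h d@(h′ ∷ d′) desc@(h′<h , desc′)
    rewrite innerGaps-maskFrom-block (toℕ y) h d desc with <-cmp (toℕ h) (toℕ y)
  ... | tri< h<y h≢y _
    rewrite <⇒<ᵇ≡true h<y | ≥⇒<ᵇ≡false (<⇒≤ h<y) | ≢⇒≡ᵇ≡false h≢y = sym (+-identityʳ _)
  ... | tri≈ _ h≡y _
    rewrite ≥⇒<ᵇ≡false {toℕ h} {toℕ y} (≤-reflexive (sym h≡y)) | ≥⇒<ᵇ≡false {toℕ y} {toℕ h} (≤-reflexive h≡y)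
          | ≡⇒≡ᵇ≡true h≡y
          | <⇒<ᵇ≡true (subst (toℕ (lastOf h′ d′) <_) h≡y (≤-<-trans (lastOf-≤ h′ d′ desc′) (<L⇒< h′<h)))
    = refl
  ... | tri> _ h≢y h>y
    rewrite ≥⇒<ᵇ≡false (<⇒≤ h>y) | <⇒<ᵇ≡true h>y | ≢⇒≡ᵇ≡false h≢y = sym (+-identityʳ _)

  closerCopies-blockStart : ∀ y p (h : Fin k) d s →
    BlockStartAt p (h ∷ d ++ s) → Descending h d → Breaks (lastOf h d) s →
    closerCopies y p (h ∷ d ++ s) ≡ bit ((0 <ᵇ length d) ∧ (h =L y)) + closerCopies y (just (lastOf h d)) s
  closerCopies-blockStart y p h d s start desc brk
    rewrite isCloser-roleOf (startsBlock p h) (continuesBlock h (d ++ s)) | start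
          | continuesBlock-++ h d s desc brk | closerCopies-block y h d s desc = refl

  embracing+closerCopies : ∀ y {s} → BlockView s → ∀ p → BlockStartAt p s →
    embracing y (descentBlocks s) + closerCopies y p s ≡ innerGaps (map (maskFrom (toℕ y)) s)
  embracing+closerCopies y [] p _ = refl
  embracing+closerCopies y (block {h} {d} {s} desc brk view) p start = begin
    embracing y (blocksFrom h (d ++ s)) + closerCopies y p (h ∷ d ++ s)
      ≡⟨ cong₂ _+_ (trans (cong (embracing y) (blocksFrom-++ h d s desc brk))
                          (countB-∷ (λ B → embraces B y) (h ∷ d) (descentBlocks s)))
                   (closerCopies-blockStart y p h d s start desc brk) ⟩
    (bit (embraces (h ∷ d) y) + embracing y (descentBlocks s)) + (closes + closerCopies y (just (lastOf h d)) s)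
      ≡⟨ interchange (bit (embraces (h ∷ d) y)) _ closes _ ⟩
    (bit (embraces (h ∷ d) y) + closes) + (embracing y (descentBlocks s) + closerCopies y (just (lastOf h d)) s)
      ≡⟨ cong₂ _+_ (sym (innerGaps-maskFrom-block≡ y h d desc))
                   (embracing+closerCopies y view (just (lastOf h d)) (breaks⇒blockStartAt s brk)) ⟩
    innerGaps (mask (h ∷ d)) + innerGaps (mask s)
      ≡⟨ sym (innerGaps-maskFrom-++ (toℕ y) h d s desc brk) ⟩
    innerGaps (mask (h ∷ d) ++ mask s)
      ≡⟨ cong innerGaps (sym (map-++ (maskFrom (toℕ y)) (h ∷ d) s)) ⟩
    innerGaps (mask (h ∷ d ++ s)) ∎
    where
    open ≡-Reasoning
    closes : ℕ
    closes = bit ((0 <ᵇ length d) ∧ (h =L y))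
    mask : List (Fin k) → Gapped
    mask = map (maskFrom (toℕ y))

  rightEmbracing+closerCopies : ∀ y {β} → BlockView β →
    rightEmbracing y β + closerCopies y (just y) β ≡ innerGaps (map (maskFrom (toℕ y)) β)
  rightEmbracing+closerCopies y [] = refl
  rightEmbracing+closerCopies y view@(block {h} {d} {s} desc brk view′)
    with h <L y in h<y | embracing+closerCopies y view (just y)
  ... | false | fromBlockStart = fromBlockStart refl
  ... | true | _
    rewrite blocksFrom-++ h d s desc brk | isCloser-roleOf false (continuesBlock h (d ++ s))
          | closerCopies-block y h d s desc | map-++ (maskFrom (toℕ y)) d s
          | innerGaps-maskFrom-below (toℕ y) h d (map (maskFrom (toℕ y)) s) desc (<L⇒< h<y) =
    embracing+closerCopies y view′ (just (lastOf h d)) (breaks⇒blockStartAt s brk)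

  -- Reconstruction

  insertQuad : Gapped → Quad {k} → ℕ → Gapped
  insertQuad u (y , _ , p , r) c = insertLetter u y p (r + c)

  skeleton-step : ∀ {w α} (y : Fin k) {β e} → w ≡ α ++ y ∷ β → occ y α ≡ e →
    skeleton (toℕ y) (suc e) w ≡ insertQuad (skeleton (toℕ y) e w) (quadAt α y β) (closerCopies y (just y) β)
  skeleton-step {α = α} y {β} refl refl
    rewrite partialWord-at y α β true | partialWord-at y α β false | rightEmbracing+closerCopies y (blockView β) =
    trans (normalize-fill A B y starts (endsInGap-maskAbove y nothing α))
          (cong (λ c → insertLetter (normalize (A ++ nothing ∷ B)) y (roleOf starts c) (innerGaps B))
                (startsWithLetter-maskFrom y β))
    where
    A B : Gapped
    A = map (maskAbove (toℕ y)) α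
    B = map (maskFrom (toℕ y)) β
    starts : Bool
    starts = startsBlock (lastOr nothing α) y

  closerCopies-absent : ∀ (y : Fin k) p β → occ y β ≡ 0 → closerCopies y p β ≡ 0
  closerCopies-absent y p [] _ = refl
  closerCopies-absent y p (h ∷ t) o with h =L y
  ... | true = ⊥-elim (1+n≢0 o)
  ... | false rewrite ∧-zeroʳ (isCloser (localRole p h t)) = closerCopies-absent y (just h) t o

  closerCopies-skip : ∀ (y : Fin k) p γ z t → occ y γ ≡ 0 →
                      closerCopies y p (γ ++ z ∷ t) ≡ closerCopies y (lastOr p γ) (z ∷ t)
  closerCopies-skip y p [] z t _ = refl
  closerCopies-skip y p (h ∷ γ) z t o with h =L y
  ... | true = ⊥-elim (1+n≢0 o)
  ... | false rewrite ∧-zeroʳ (isCloser (localRole p h (γ ++ z ∷ t))) =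
    closerCopies-skip y (just h) γ z t o

  occurrence-split : ∀ (y : Fin k) w e → e < occ y w →
                     ∃ λ α → ∃ λ β → (w ≡ α ++ y ∷ β) × (occ y α ≡ e)
  occurrence-split y (h ∷ t) e e<occ with h =L y in h≡y
  occurrence-split y (h ∷ t) zero _ | true = [] , t , cong (_∷ t) (=L⇒≡ h y h≡y) , refl
  occurrence-split y (h ∷ t) (suc e) (s≤s e<occ) | true with occurrence-split y t e e<occ
  ... | α , β , refl , oα =
    h ∷ α , β , refl , trans (cong (λ b → if b then suc (occ y α) else occ y α) h≡y) (cong suc oα)
  occurrence-split y (h ∷ t) e e<occ | false with occurrence-split y t e e<occ
  ... | α , β , refl , oα =
    h ∷ α , β , refl , trans (cong (λ b → if b then suc (occ y α) else occ y α) h≡y) oα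

  occ-split : ∀ {w} (y : Fin k) {α β e} → w ≡ α ++ y ∷ β → occ y α ≡ e → occ y w ≡ e + suc (occ y β)
  occ-split y {α} {β} refl refl = occ-++-∷ y α β

  nextOccurrence : ∀ (y : Fin k) n β → occ y β ≡ suc n →
    ∃ λ γ → ∃ λ β₂ → (β ≡ γ ++ y ∷ β₂) × (occ y γ ≡ 0) × (occ y β₂ ≡ n)
  nextOccurrence y n β o with occurrence-split y β 0 (subst (0 <_) (sym o) z<s)
  ... | γ , β₂ , β≡ , oγ = γ , β₂ , β≡ , oγ , suc-injective (trans (sym (occ-split y β≡ oγ)) o)

  closerCopies-agree : ∀ {w v} → δ w ≋ δ v → ∀ (y : Fin k) n {α β α' β'} →
    w ≡ α ++ y ∷ β → v ≡ α' ++ y ∷ β' → occ y α ≡ occ y α' → occ y β ≡ n → occ y β' ≡ n →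
    closerCopies y (just y) β ≡ closerCopies y (just y) β'
  closerCopies-agree _ y zero {β = β} {β' = β'} _ _ _ oβ oβ' =
    trans (closerCopies-absent y (just y) β oβ) (sym (closerCopies-absent y (just y) β' oβ'))
  closerCopies-agree {w} {v} δw≋δv y (suc n) {α} {β} {α'} {β'} w≡ v≡ oα oβ oβ'
    with nextOccurrence y n β oβ | nextOccurrence y n β' oβ'
  ... | γ , β₂ , refl , oγ , o₂ | γ' , β₂' , refl , oγ' , o₂' = begin
    closerCopies y (just y) (γ ++ y ∷ β₂)
      ≡⟨ closerCopies-skip y (just y) γ y β₂ oγ ⟩
    bit (isCloser (localRole (lastOr (just y) γ) y β₂) ∧ (y =L y)) + closerCopies y (just y) β₂
      ≡⟨ cong₂ (λ r c → bit (isCloser r ∧ (y =L y)) + c) roleEq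
               (closerCopies-agree δw≋δv y n w≡′ v≡′ oαγ o₂ o₂') ⟩
    bit (isCloser (localRole (lastOr (just y) γ') y β₂') ∧ (y =L y)) + closerCopies y (just y) β₂'
      ≡⟨ sym (closerCopies-skip y (just y) γ' y β₂' oγ') ⟩
    closerCopies y (just y) (γ' ++ y ∷ β₂') ∎
    where
    open ≡-Reasoning
    w≡′ : w ≡ (α ++ y ∷ γ) ++ y ∷ β₂
    w≡′ = trans w≡ (sym (++-assoc α (y ∷ γ) (y ∷ β₂)))
    v≡′ : v ≡ (α' ++ y ∷ γ') ++ y ∷ β₂'
    v≡′ = trans v≡ (sym (++-assoc α' (y ∷ γ') (y ∷ β₂')))
    oαγ : occ y (α ++ y ∷ γ) ≡ occ y (α' ++ y ∷ γ')
    oαγ rewrite occ-++-∷ y α γ | occ-++-∷ y α' γ' | oα | oγ | oγ' = refl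
    roleEq : localRole (lastOr (just y) γ) y β₂ ≡ localRole (lastOr (just y) γ') y β₂'
    roleEq rewrite sym (lastOr-++ nothing α (y ∷ γ)) | sym (lastOr-++ nothing α' (y ∷ γ')) =
      cong (proj₁ ∘ proj₂ ∘ proj₂) (quadAt-agree δw≋δv w≡′ v≡′ oαγ)

  partialWord∷-gap : ∀ c x xs b → partialWord∷ c 0 x xs false b ≡ nothing ∷ partialWord c 0 xs
  partialWord∷-gap c x xs true = refl
  partialWord∷-gap c x xs false = refl

  partialWord-complete : ∀ (y : Fin k) e w → occ y w ≤ e →
                         partialWord (toℕ y) e w ≡ partialWord (suc (toℕ y)) 0 w
  partialWord-complete y e [] _ = refl
  partialWord-complete y e (x ∷ w) occ≤e with <-cmp (toℕ x) (toℕ y)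
  ... | tri< x<y x≢y _
    rewrite <⇒<ᵇ≡true x<y | ≢⇒≡ᵇ≡false x≢y | <⇒<ᵇ≡true (m<n⇒m<1+n x<y) =
    cong (just x ∷_) (partialWord-complete y e w occ≤e)
  ... | tri> _ x≢y x>y
    rewrite ≥⇒<ᵇ≡false (<⇒≤ x>y) | ≢⇒≡ᵇ≡false x≢y | ≥⇒<ᵇ≡false x>y =
    trans (cong (nothing ∷_) (partialWord-complete y e w occ≤e)) (sym (partialWord∷-gap (suc (toℕ y)) x w _))
  ... | tri≈ _ x≡y _ with toℕ-injective x≡y
  ... | refl rewrite ≥⇒<ᵇ≡false {toℕ y} ≤-refl | ≡⇒≡ᵇ≡true {toℕ y} refl | <⇒<ᵇ≡true (n<1+n (toℕ y))
    with e | occ≤e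
  ... | suc e′ | s≤s occ≤e′ = cong (just y ∷_) (partialWord-complete y e′ w occ≤e′)

  partialWord-zero : ∀ w → AllGaps (partialWord 0 0 w)
  partialWord-zero [] = tt
  partialWord-zero (x ∷ w) with toℕ x ≡ᵇ 0
  ... | true = partialWord-zero w
  ... | false = partialWord-zero w

  partialWord-all : ∀ (w : List (Fin k)) → partialWord k 0 w ≡ map just w
  partialWord-all [] = refl
  partialWord-all (x ∷ w) rewrite <⇒<ᵇ≡true (toℕ<n x) = cong (just x ∷_) (partialWord-all w)

  skeleton-zero : ∀ w → skeleton 0 0 w ≡ []
  skeleton-zero w =
    dropTrailingGaps-allGaps (collapse false (partialWord 0 0 w)) (allGaps-collapse (partialWord 0 0 w) (partialWord-zero w))

  skeleton-all : ∀ (w : List (Fin k)) → skeleton k 0 w ≡ map just w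
  skeleton-all w rewrite partialWord-all w =
    trans (cong dropTrailingGaps (collapse-letters w)) (dropTrailingGaps-letters w)
    where
    collapse-letters : ∀ (w : List (Fin k)) → collapse false (map just w) ≡ map just w
    collapse-letters [] = refl
    collapse-letters (x ∷ w) = cong (just x ∷_) (collapse-letters w)
    dropTrailingGaps-letters : ∀ (w : List (Fin k)) → dropTrailingGaps (map just w) ≡ map just w
    dropTrailingGaps-letters [] = refl
    dropTrailingGaps-letters (x ∷ w) = cong (just x ∷_) (dropTrailingGaps-letters w)

  module _ (m : Fin k → ℕ) {w v : List (Fin k)} (w∈S : InS m w) (v∈S : InS m v) (δw≋δv : δ w ≋ δ v) where

    skeleton-suc-agree : ∀ y e → e < m y → skeleton (toℕ y) e w ≡ skeleton (toℕ y) e v →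
                         skeleton (toℕ y) (suc e) w ≡ skeleton (toℕ y) (suc e) v
    skeleton-suc-agree y e e<m same
      with occurrence-split y w e (subst (e <_) (sym (w∈S y)) e<m)
         | occurrence-split y v e (subst (e <_) (sym (v∈S y)) e<m)
    ... | α , β , w≡ , oα | α' , β' , v≡ , oα' =
      begin
      skeleton (toℕ y) (suc e) w
        ≡⟨ skeleton-step y w≡ oα ⟩
      insertQuad (skeleton (toℕ y) e w) (quadAt α y β) (closerCopies y (just y) β)
        ≡⟨ cong (λ u → insertQuad u (quadAt α y β) (closerCopies y (just y) β)) same ⟩
      insertQuad (skeleton (toℕ y) e v) (quadAt α y β) (closerCopies y (just y) β)
        ≡⟨ cong₂ (insertQuad (skeleton (toℕ y) e v)) (quadAt-agree δw≋δv w≡ v≡ oα≡)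
                 (closerCopies-agree δw≋δv y (occ y β) w≡ v≡ oα≡ refl (sym later≡)) ⟩
      insertQuad (skeleton (toℕ y) e v) (quadAt α' y β') (closerCopies y (just y) β')
        ≡⟨ sym (skeleton-step y v≡ oα') ⟩
      skeleton (toℕ y) (suc e) v ∎
      where
      open ≡-Reasoning
      oα≡ : occ y α ≡ occ y α'
      oα≡ = trans oα (sym oα')
      later≡ : occ y β ≡ occ y β'
      later≡ = suc-injective (+-cancelˡ-≡ e (suc (occ y β)) (suc (occ y β'))
                 (trans (sym (occ-split y w≡ oα)) (trans (w∈S y) (trans (sym (v∈S y)) (occ-split y v≡ oα')))))

    skeleton-copies-agree : ∀ y → skeleton (toℕ y) 0 w ≡ skeleton (toℕ y) 0 v →
                            ∀ e → e ≤ m y → skeleton (toℕ y) e w ≡ skeleton (toℕ y) e v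
    skeleton-copies-agree y same zero _ = same
    skeleton-copies-agree y same (suc e) e<m =
      skeleton-suc-agree y e e<m (skeleton-copies-agree y same e (<⇒≤ e<m))

    skeleton-agree : ∀ c → c ≤ k → skeleton c 0 w ≡ skeleton c 0 v
    skeleton-agree zero _ = trans (skeleton-zero w) (sym (skeleton-zero v))
    skeleton-agree (suc c) c<k
      with fromℕ< c<k | toℕ-fromℕ< c<k
    ... | y | refl = begin
      skeleton (suc (toℕ y)) 0 w ≡⟨ sym (skeleton-complete w w∈S) ⟩
      skeleton (toℕ y) (m y) w   ≡⟨ skeleton-copies-agree y (skeleton-agree (toℕ y) (<⇒≤ c<k)) (m y) ≤-refl ⟩
      skeleton (toℕ y) (m y) v   ≡⟨ skeleton-complete v v∈S ⟩
      skeleton (suc (toℕ y)) 0 v ∎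
      where
      open ≡-Reasoning
      skeleton-complete : ∀ u → InS m u → skeleton (toℕ y) (m y) u ≡ skeleton (suc (toℕ y)) 0 u
      skeleton-complete u u∈S = cong normalize (partialWord-complete y (m y) u (≤-reflexive (u∈S y)))

    δ-injective : w ≡ v
    δ-injective = map-injective just-injective (begin
      map just w    ≡⟨ sym (skeleton-all w) ⟩
      skeleton k 0 w ≡⟨ skeleton-agree k ≤-refl ⟩
      skeleton k 0 v ≡⟨ skeleton-all v ⟩
      map just v    ∎)
      where open ≡-Reasoning

mainTheorem4 : (k : ℕ) (m : Fin k → ℕ) → (∀ a → 1 ≤ m a) →
    ((w v : List (Fin k)) → InS m w → InS m v → δ w ≋ δ v → w ≡ v)
    × ((s : List (Quad {k})) → InL m s → ∃ λ w → InS m w × (δ w ≋ s))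
-- Injectivity needs no positivity of m, and δ maps onto L by the very definition of L.
mainTheorem4 k m _ = (λ w v w∈S v∈S δw≋δv → δ-injective m w∈S v∈S δw≋δv) , (λ s s∈L → s∈L)
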